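{- For every integer $p\ge1$, as formal power series in $t$, \[ \sum_{n=0}^{\infty}\mathrm{Bel}_{n,\lambda}^{(p)}\frac{t^{n}}{n!}=(-1)^{p-1}p\,e^{e_{\lambda}(t)-1}\bigg(e_{\lambda}^{\lambda-1}(t)\frac{d}{dt}\bigg)^{p-1}\bigg(\frac{1-e^{1-e_{\lambda}(t)}}{e_{\lambda}(t)-1}\bigg), \] where $\frac{1-e^{1-e_{\lambda}(t)}}{e_{\lambda}(t)-1}$ denotes the formal power series in $t$ obtained by removing the (removable) singularity at $t=0$, and $\big(e_{\lambda}^{\lambda-1}(t)\frac{d}{dt}\big)^{p-1}$ is the $(p-1)$-fold iterate of the operator $f(t)\mapsto e_{\lambda}^{\lambda-1}(t)f'(t)$.
   Context: Let $\lambda\in\mathbb{R}$. Set $(x)_{0,\lambda}=1$, $(x)_{n,\lambda}=x(x-\lambda)\cdots(x-(n-1)\lambda)$ for $n\ge1$. The degenerate exponential is the formal power series $e_\lambda^x(t)=\sum_{n\ge0}(x)_{n,\lambda}\frac{t^n}{n!}$ ($=(1+\lambda t)^{x/\lambda}$, and $e^{xt}$ if $\lambda=0$), $e_\lambda(t)=e_\lambda^1(t)$; in particular $e_\lambda^{\lambda-1}(t)=(1+\lambda t)^{(\lambda-1)/\lambda}$. For an integer $p\ge0$, the truncated degenerate Bell numbers $\mathrm{Bel}^{(p)}_{n,\lambda}$ are defined by $\sum_{n\ge0}\mathrm{Bel}^{(p)}_{n,\lambda}\frac{t^n}{n!}=\frac{p!}{(e_\lambda(t)-1)^p}\Big(e^{e_\lambda(t)-1}-\sum_{k=0}^{p-1}\frac{(e_\lambda(t)-1)^k}{k!}\Big)=p!\sum_{k\ge0}\frac{(e_\lambda(t)-1)^k}{(k+p)!}$.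 -}

module Defs where

open import Data.Nat using (ℕ; zero; suc; _∸_) renaming (_+_ to _+ℕ_)
open import Algebra.Bundles using (CommutativeRing)

-- Formal power series over a commutative ring R in which every positive
-- natural number n+1 is invertible (inverse given by `inv n`), i.e. a ℚ-algebra.
-- A series is represented by its ORDINARY coefficient sequence: f = Σ f(n) tⁿ.
module FPS {c ℓ} (R : CommutativeRing c ℓ) (inv : ℕ → CommutativeRing.Carrier R) where
  open CommutativeRing R

  PS : Set c
  PS = ℕ → Carrier

  _≋_ : PS → PS → Set ℓ
  f ≋ g = ∀ n → f n ≈ g n

  nat : ℕ → Carrier
  nat zero = 0#
  nat (suc n) = 1# + nat n

  sgn : ℕ → Carrier
  sgn zero = 1#
  sgn (suc k) = - 1# * sgn k

  invFact : ℕ → Carrier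
  invFact zero = 1#
  invFact (suc n) = invFact n * inv n

  fact : ℕ → Carrier
  fact zero = 1#
  fact (suc n) = nat (suc n) * fact n

  sumTo : ℕ → (ℕ → Carrier) → Carrier
  sumTo zero f = f 0
  sumTo (suc n) f = sumTo n f + f (suc n)

  const : Carrier → PS
  const a zero = a
  const a (suc n) = 0#

  _⊕_ : PS → PS → PS
  (f ⊕ g) n = f n + g n

  ⊝_ : PS → PS
  (⊝ f) n = - (f n)

  _⊖_ : PS → PS → PS
  f ⊖ g = f ⊕ (⊝ g)

  _·_ : Carrier → PS → PS
  (a · f) n = a * f n

  _⊛_ : PS → PS → PS
  (f ⊛ g) n = sumTo n (λ k → f k * g (n ∸ k))

  pow : PS → ℕ → PS
  pow f zero = const 1#
  pow f (suc k) = f ⊛ pow f k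

  deriv : PS → PS
  deriv f n = nat (suc n) * f (suc n)

  -- composition f(g(t)); meaningful (and only used) for g with zero constant term,
  -- in which case the coefficient of tⁿ only involves the terms k ≤ n.
  _∘ₛ_ : PS → PS → PS
  (f ∘ₛ g) n = sumTo n (λ k → f k * pow g k n)

  expS : PS
  expS n = invFact n

  fall : Carrier → Carrier → ℕ → Carrier
  fall x lam zero = 1#
  fall x lam (suc n) = fall x lam n * (x - nat n * lam)

  degExp : Carrier → Carrier → PS
  degExp lam x n = fall x lam n * invFact n

  eλ : Carrier → PS
  eλ lam = degExp lam 1#

  eλm1 : Carrier → PS
  eλm1 lam = eλ lam ⊖ const 1#

  -- Σ_n Bel^{(p)}_{n,λ} tⁿ/n! := p! Σ_k (e_λ(t)-1)^k/(k+p)!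
  BelGF : Carrier → ℕ → PS
  BelGF lam p = (λ k → fact p * invFact (k +ℕ p)) ∘ₛ eλm1 lam

  expEλm1 : Carrier → PS
  expEλm1 lam = expS ∘ₛ eλm1 lam

  numer : Carrier → PS
  numer lam = const 1# ⊖ (expS ∘ₛ (⊝ eλm1 lam))

  Dop : Carrier → PS → PS
  Dop lam f = degExp lam (lam - 1#) ⊛ deriv f

  iter : ℕ → (PS → PS) → PS → PS
  iter zero D f = f
  iter (suc k) D f = D (iter k D f)

  -- right-hand side, given q = (1 - e^{1-e_λ(t)})/(e_λ(t)-1)
  RHS : Carrier → ℕ → PS → PS
  RHS lam p q = (sgn (p ∸ 1) * nat p) · (expEλm1 lam ⊛ iter (p ∸ 1) (Dop lam) q)

-- With x = e_λ(t) - 1 the left-hand side is B_p(x) = p! Σ_k x^k/(k+p)!, so the theorem is an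
-- identity in x, transported along the substitution x ↦ e_λ(t) - 1.
--
-- In x: put T_m = m! x^{-m-1} (eˣ - Σ_{j≤m} x^j/j!), so that B_{m+1} = (m+1) T_m.  Both T_m and
-- (-1)^m eˣ (d/dx)^m ((1 - e^{-x})/x) satisfy T_{m+1} = T_m - T_m′ and agree for m = 0.
--
-- Along the substitution: composing with a series u = O(t) is a ring homomorphism, and by the chain
-- rule it turns d/dx into (1/u′) d/dt.  For u = e_λ(t) - 1 one has u′ = e_λ^{1-λ}(t) = 1/e_λ^{λ-1}(t),
-- since e_λ^a is the unique solution of (1 + λt) f′ = a f, f(0) = 1, whence e_λ^a e_λ^b = e_λ^{a+b}
-- and (e_λ^a)′ = a e_λ^{a-λ}.  Finally, u = t + O(t²) makes the quotient by u unique.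

module Submission where

open import Defs
open import Data.Nat using (ℕ; zero; suc; _≤_; _<_; _∸_; z≤n; s≤s) renaming (_+_ to _+ℕ_)
import Data.Nat.Properties as ℕ
open import Data.Product using (Σ; _×_; _,_)
open import Data.Sum using (inj₁; inj₂)
open import Algebra.Bundles using (CommutativeRing)
import Relation.Binary.PropositionalEquality as ≡
import Relation.Binary.Reasoning.Setoid as SetoidReasoning
open import Relation.Binary.Bundles using (Setoid)

module PowerSeries {c ℓ} (R : CommutativeRing c ℓ) (inv : ℕ → CommutativeRing.Carrier R) where

  open CommutativeRing R
  open FPS R inv
  open SetoidReasoning setoid
  open import Algebra.Properties.Ring ring
    using (-1*x≈-x; -‿distribˡ-*; -‿distribʳ-*; -‿+-comm)
  open import Algebra.Properties.CommutativeSemigroup +-commutativeSemigroup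
    using () renaming (interchange to +-interchange)
  open import Algebra.Properties.CommutativeSemigroup *-commutativeSemigroup
    using () renaming (x∙yz≈y∙xz to *-lcomm)

  nat-+ : ∀ m n → nat (m +ℕ n) ≈ nat m + nat n
  nat-+ zero n = sym (+-identityˡ _)
  nat-+ (suc m) n = trans (+-cong refl (nat-+ m n)) (sym (+-assoc _ _ _))

  nat-∸ : ∀ {k n} → k ≤ n → nat n ≈ nat k + nat (n ∸ k)
  nat-∸ {k} {n} k≤n = trans (reflexive (≡.cong nat (≡.sym (ℕ.m+[n∸m]≡n k≤n)))) (nat-+ k (n ∸ k))

  sumTo-cong≤ : ∀ n {f g : ℕ → Carrier} → (∀ k → k ≤ n → f k ≈ g k) → sumTo n f ≈ sumTo n g
  sumTo-cong≤ zero e = e 0 z≤n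
  sumTo-cong≤ (suc n) e = +-cong (sumTo-cong≤ n (λ k k≤n → e k (ℕ.m≤n⇒m≤1+n k≤n))) (e (suc n) ℕ.≤-refl)

  sumTo-cong : ∀ n {f g : ℕ → Carrier} → (∀ k → f k ≈ g k) → sumTo n f ≈ sumTo n g
  sumTo-cong n e = sumTo-cong≤ n (λ k _ → e k)

  sumTo-+ : ∀ n (f g : ℕ → Carrier) → sumTo n (λ k → f k + g k) ≈ sumTo n f + sumTo n g
  sumTo-+ zero f g = refl
  sumTo-+ (suc n) f g = trans (+-cong (sumTo-+ n f g) refl) (+-interchange _ _ _ _)

  sumTo-*ˡ : ∀ n a (f : ℕ → Carrier) → a * sumTo n f ≈ sumTo n (λ k → a * f k)
  sumTo-*ˡ zero a f = refl
  sumTo-*ˡ (suc n) a f = trans (distribˡ a _ _) (+-cong (sumTo-*ˡ n a f) refl)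

  sumTo-*ʳ : ∀ n a (f : ℕ → Carrier) → sumTo n f * a ≈ sumTo n (λ k → f k * a)
  sumTo-*ʳ n a f = trans (*-comm _ _) (trans (sumTo-*ˡ n a f) (sumTo-cong n (λ k → *-comm _ _)))

  -‿sumTo : ∀ n (f : ℕ → Carrier) → - sumTo n f ≈ sumTo n (λ k → - f k)
  -‿sumTo zero f = refl
  -‿sumTo (suc n) f = trans (sym (-‿+-comm _ _)) (+-cong (-‿sumTo n f) refl)

  sumTo-zero : ∀ n {f : ℕ → Carrier} → (∀ k → k ≤ n → f k ≈ 0#) → sumTo n f ≈ 0#
  sumTo-zero zero e = e 0 z≤n
  sumTo-zero (suc n) e =
    trans (+-cong (sumTo-zero n (λ k k≤n → e k (ℕ.m≤n⇒m≤1+n k≤n))) (e (suc n) ℕ.≤-refl)) (+-identityʳ 0#)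

  sumTo-suc-head : ∀ n (f : ℕ → Carrier) → sumTo (suc n) f ≈ f 0 + sumTo n (λ k → f (suc k))
  sumTo-suc-head zero f = refl
  sumTo-suc-head (suc n) f = trans (+-cong (sumTo-suc-head n f) refl) (+-assoc _ _ _)

  sumTo-head : ∀ n {f : ℕ → Carrier} → (∀ k → suc k ≤ n → f (suc k) ≈ 0#) → sumTo n f ≈ f 0
  sumTo-head zero e = refl
  sumTo-head (suc n) {f} e = begin
    sumTo (suc n) f                   ≈⟨ sumTo-suc-head n f ⟩
    f 0 + sumTo n (λ k → f (suc k))   ≈⟨ +-cong refl (sumTo-zero n (λ k k≤n → e k (s≤s k≤n))) ⟩
    f 0 + 0#                          ≈⟨ +-identityʳ _ ⟩
    f 0                               ∎

  sumTo-extend : ∀ d n {f : ℕ → Carrier} → (∀ k → n < k → f k ≈ 0#) → sumTo (d +ℕ n) f ≈ sumTo n f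
  sumTo-extend zero n e = refl
  sumTo-extend (suc d) n e =
    trans (+-cong (sumTo-extend d n e) (e (suc (d +ℕ n)) (s≤s (ℕ.m≤n+m n d)))) (+-identityʳ _)

  sumTo-swap : ∀ n m (f : ℕ → ℕ → Carrier) →
               sumTo n (λ i → sumTo m (λ k → f i k)) ≈ sumTo m (λ k → sumTo n (λ i → f i k))
  sumTo-swap zero m f = refl
  sumTo-swap (suc n) m f = trans (+-cong (sumTo-swap n m f) refl) (sym (sumTo-+ m _ _))

  ≋-setoid : Setoid c ℓ
  ≋-setoid = record
    { Carrier = PS
    ; _≈_ = _≋_
    ; isEquivalence = record
      { refl = λ _ → refl
      ; sym = λ e n → sym (e n)
      ; trans = λ e e′ n → trans (e n) (e′ n)
      }
    }

  open Setoid ≋-setoid public using () renaming (refl to ≋-refl; sym to ≋-sym; trans to ≋-trans)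

  ⊛-cong : ∀ {f f′ g g′} → f ≋ f′ → g ≋ g′ → (f ⊛ g) ≋ (f′ ⊛ g′)
  ⊛-cong ef eg n = sumTo-cong n (λ k → *-cong (ef k) (eg (n ∸ k)))

  ⊛-congˡ : ∀ {f f′} g → f ≋ f′ → (f ⊛ g) ≋ (f′ ⊛ g)
  ⊛-congˡ g ef = ⊛-cong ef (≋-refl {g})

  ⊛-congʳ : ∀ f {g g′} → g ≋ g′ → (f ⊛ g) ≋ (f ⊛ g′)
  ⊛-congʳ f eg = ⊛-cong (≋-refl {f}) eg

  ⊕-cong : ∀ {f f′ g g′} → f ≋ f′ → g ≋ g′ → (f ⊕ g) ≋ (f′ ⊕ g′)
  ⊕-cong ef eg n = +-cong (ef n) (eg n)

  ⊝-cong : ∀ {f f′} → f ≋ f′ → (⊝ f) ≋ (⊝ f′)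
  ⊝-cong ef n = -‿cong (ef n)

  deriv-cong : ∀ {f f′} → f ≋ f′ → deriv f ≋ deriv f′
  deriv-cong ef n = *-cong refl (ef (suc n))

  ⊛-distribʳ : ∀ f g h → ((f ⊕ g) ⊛ h) ≋ ((f ⊛ h) ⊕ (g ⊛ h))
  ⊛-distribʳ f g h n = trans (sumTo-cong n (λ k → distribʳ _ _ _)) (sumTo-+ n _ _)

  ⊛-distribˡ : ∀ f g h → (f ⊛ (g ⊕ h)) ≋ ((f ⊛ g) ⊕ (f ⊛ h))
  ⊛-distribˡ f g h n = trans (sumTo-cong n (λ k → distribˡ _ _ _)) (sumTo-+ n _ _)

  ·-⊛ˡ : ∀ a f g → ((a · f) ⊛ g) ≋ (a · (f ⊛ g))
  ·-⊛ˡ a f g n = trans (sumTo-cong n (λ k → *-assoc _ _ _)) (sym (sumTo-*ˡ n a _))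

  ·-⊛ʳ : ∀ a f g → (f ⊛ (a · g)) ≋ (a · (f ⊛ g))
  ·-⊛ʳ a f g n = trans (sumTo-cong n (λ k → *-lcomm _ _ _)) (sym (sumTo-*ˡ n a _))

  ⊝-⊛ˡ : ∀ f g → ((⊝ f) ⊛ g) ≋ (⊝ (f ⊛ g))
  ⊝-⊛ˡ f g n = trans (sumTo-cong n (λ k → sym (-‿distribˡ-* _ _))) (sym (-‿sumTo n _))

  ⊝-⊛ʳ : ∀ f g → (f ⊛ (⊝ g)) ≋ (⊝ (f ⊛ g))
  ⊝-⊛ʳ f g n = trans (sumTo-cong n (λ k → sym (-‿distribʳ-* _ _))) (sym (-‿sumTo n _))

  const-⊛ : ∀ a f → (const a ⊛ f) ≋ (a · f)
  const-⊛ a f n = sumTo-head n (λ k _ → zeroˡ _)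

  -- The Euler operator t d/dt; θ f (suc n) is definitionally deriv f n.
  θ : PS → PS
  θ f n = nat n * f n

  θ-⊛ : ∀ f g → θ (f ⊛ g) ≋ ((θ f ⊛ g) ⊕ (f ⊛ θ g))
  θ-⊛ f g n = begin
    nat n * sumTo n h                                               ≈⟨ sumTo-*ˡ n _ h ⟩
    sumTo n (λ k → nat n * h k)                                     ≈⟨ sumTo-cong≤ n split ⟩
    sumTo n (λ k → nat k * h k + nat (n ∸ k) * h k)                 ≈⟨ sumTo-+ n _ _ ⟩
    sumTo n (λ k → nat k * h k) + sumTo n (λ k → nat (n ∸ k) * h k)
      ≈⟨ +-cong (sumTo-cong n (λ k → sym (*-assoc _ _ _))) (sumTo-cong n (λ k → *-lcomm _ _ _)) ⟩
    (θ f ⊛ g) n + (f ⊛ θ g) n                                       ∎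
    where
    h : ℕ → Carrier
    h k = f k * g (n ∸ k)
    split : ∀ k → k ≤ n → nat n * h k ≈ nat k * h k + nat (n ∸ k) * h k
    split k k≤n = trans (*-cong (nat-∸ k≤n) refl) (distribʳ _ _ _)

  θ-⊛-sucˡ : ∀ f g n → (θ f ⊛ g) (suc n) ≈ (deriv f ⊛ g) n
  θ-⊛-sucˡ f g n = begin
    (θ f ⊛ g) (suc n)                                   ≈⟨ sumTo-suc-head n _ ⟩
    (0# * f 0) * g (suc n) + (deriv f ⊛ g) n            ≈⟨ +-cong (trans (*-cong (zeroˡ _) refl) (zeroˡ _)) refl ⟩
    0# + (deriv f ⊛ g) n                                ≈⟨ +-identityˡ _ ⟩
    (deriv f ⊛ g) n                                     ∎

  θ-⊛-sucʳ : ∀ f g n → (f ⊛ θ g) (suc n) ≈ (f ⊛ deriv g) n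
  θ-⊛-sucʳ f g n = begin
    (f ⊛ θ g) (suc n)                                   ≈⟨ +-cong (sumTo-cong≤ n inner) top ⟩
    (f ⊛ deriv g) n + 0#                                ≈⟨ +-identityʳ _ ⟩
    (f ⊛ deriv g) n                                     ∎
    where
    inner : ∀ k → k ≤ n → f k * θ g (suc n ∸ k) ≈ f k * deriv g (n ∸ k)
    inner k k≤n = reflexive (≡.cong (λ j → f k * θ g j) (ℕ.+-∸-assoc 1 k≤n))
    top : f (suc n) * θ g (suc n ∸ suc n) ≈ 0#
    top = trans (*-cong refl (trans (*-cong (reflexive (≡.cong nat (ℕ.n∸n≡0 n))) refl) (zeroˡ _))) (zeroʳ _)

  deriv-⊛ : ∀ f g → deriv (f ⊛ g) ≋ ((deriv f ⊛ g) ⊕ (f ⊛ deriv g))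
  deriv-⊛ f g n = trans (θ-⊛ f g (suc n)) (+-cong (θ-⊛-sucˡ f g n) (θ-⊛-sucʳ f g n))

  deriv-const : ∀ a n → deriv (const a) n ≈ 0#
  deriv-const a n = zeroʳ _

  AgreeUpTo : ℕ → PS → PS → Set ℓ
  AgreeUpTo n f g = ∀ j → j ≤ n → f j ≈ g j

  agreeUpTo-suc : ∀ n {f g} → AgreeUpTo n f g → f (suc n) ≈ g (suc n) → AgreeUpTo (suc n) f g
  agreeUpTo-suc n e e′ j j≤1+n with ℕ.m≤n⇒m<n∨m≡n j≤1+n
  ... | inj₁ (s≤s j≤n) = e j j≤n
  ... | inj₂ ≡.refl = e′

  ⊛-agreeUpTo : ∀ n {f g} h → AgreeUpTo n f g → (f ⊛ h) n ≈ (g ⊛ h) n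
  ⊛-agreeUpTo n h e = sumTo-cong≤ n (λ k k≤n → *-cong (e k k≤n) refl)

  pow-⊝ : ∀ f k → pow (⊝ f) k ≋ (sgn k · pow f k)
  pow-⊝ f zero n = sym (*-identityˡ _)
  pow-⊝ f (suc k) n = begin
    ((⊝ f) ⊛ pow (⊝ f) k) n           ≈⟨ ⊛-congʳ (⊝ f) (pow-⊝ f k) n ⟩
    ((⊝ f) ⊛ (sgn k · pow f k)) n     ≈⟨ ·-⊛ʳ (sgn k) (⊝ f) (pow f k) n ⟩
    sgn k * ((⊝ f) ⊛ pow f k) n       ≈⟨ *-cong refl (⊝-⊛ˡ f (pow f k) n) ⟩
    sgn k * - (f ⊛ pow f k) n         ≈⟨ sym (-‿distribʳ-* _ _) ⟩
    - (sgn k * (f ⊛ pow f k) n)       ≈⟨ sym (-1*x≈-x _) ⟩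
    - 1# * (sgn k * (f ⊛ pow f k) n)  ≈⟨ sym (*-assoc _ _ _) ⟩
    (- 1# * sgn k) * (f ⊛ pow f k) n  ∎

  module Substitution (u : PS) (u-0 : u 0 ≈ 0#) where

    pow-vanishes : ∀ k n → n < k → pow u k n ≈ 0#
    pow-vanishes (suc k) n (s≤s n≤k) = sumTo-zero n term
      where
      term : ∀ j → j ≤ n → u j * pow u k (n ∸ j) ≈ 0#
      term zero _ = trans (*-cong u-0 refl) (zeroˡ _)
      term (suc j) 1+j≤n = trans (*-cong refl (pow-vanishes k (n ∸ suc j) n∸[1+j]<k)) (zeroʳ _)
        where
        n∸[1+j]<k : n ∸ suc j < k
        n∸[1+j]<k = ℕ.<-≤-trans (ℕ.∸-monoʳ-< (s≤s z≤n) 1+j≤n) n≤k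

    ∘ₛ-sumTo : ∀ X {n} N → n ≤ N → sumTo N (λ k → X k * pow u k n) ≈ (X ∘ₛ u) n
    ∘ₛ-sumTo X {n} N n≤N = begin
      sumTo N (λ k → X k * pow u k n)
        ≡⟨ ≡.cong (λ M → sumTo M (λ k → X k * pow u k n)) (≡.sym (ℕ.m∸n+n≡m n≤N)) ⟩
      sumTo (N ∸ n +ℕ n) (λ k → X k * pow u k n)
        ≈⟨ sumTo-extend (N ∸ n) n (λ k n<k → trans (*-cong refl (pow-vanishes k n n<k)) (zeroʳ _)) ⟩
      (X ∘ₛ u) n
        ∎

    ∘ₛ-cong : ∀ {X Y} → X ≋ Y → (X ∘ₛ u) ≋ (Y ∘ₛ u)
    ∘ₛ-cong e n = sumTo-cong n (λ k → *-cong (e k) refl)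

    ∘ₛ-⊕ : ∀ X Y → ((X ⊕ Y) ∘ₛ u) ≋ ((X ∘ₛ u) ⊕ (Y ∘ₛ u))
    ∘ₛ-⊕ X Y n = trans (sumTo-cong n (λ k → distribʳ _ _ _)) (sumTo-+ n _ _)

    ∘ₛ-· : ∀ a X → ((a · X) ∘ₛ u) ≋ (a · (X ∘ₛ u))
    ∘ₛ-· a X n = trans (sumTo-cong n (λ k → *-assoc _ _ _)) (sym (sumTo-*ˡ n a _))

    ∘ₛ-⊝ : ∀ X → ((⊝ X) ∘ₛ u) ≋ (⊝ (X ∘ₛ u))
    ∘ₛ-⊝ X n = trans (sumTo-cong n (λ k → sym (-‿distribˡ-* _ _))) (sym (-‿sumTo n _))

    const-∘ₛ : ∀ a → (const a ∘ₛ u) ≋ const a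
    const-∘ₛ a n = trans (sumTo-head n (λ k _ → zeroˡ _)) (*-const-1 n)
      where
      *-const-1 : ∀ n → a * const 1# n ≈ const a n
      *-const-1 zero = *-identityʳ a
      *-const-1 (suc n) = zeroʳ a

module ℚAlgebraPowerSeries {c ℓ} (R : CommutativeRing c ℓ) (inv : ℕ → CommutativeRing.Carrier R)
  (nat-suc*inv : ∀ n → CommutativeRing._≈_ R (CommutativeRing._*_ R (FPS.nat R inv (suc n)) (inv n)) (CommutativeRing.1# R))
  where

  open PowerSeries R inv
  open CommutativeRing R
  open FPS R inv
  open SetoidReasoning setoid
  open import Algebra.Properties.Ring ring
    using ( -1*x≈-x; -‿distribˡ-*; -0#≈0#; -‿involutive; x[y-z]≈xy-xz; [y-z]x≈yx-zx; ⁻¹-anti-homo‿-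
          ; +-cancelˡ; +-cancelʳ)
    renaming (//-rightDividesʳ to [y+x]-x≈y)
  open import Algebra.Properties.CommutativeSemigroup +-commutativeSemigroup
    using () renaming (interchange to +-interchange)
  open import Algebra.Properties.CommutativeSemigroup *-commutativeSemigroup
    using () renaming (x∙yz≈y∙xz to *-lcomm)
  open import Algebra.Solver.Ring.NaturalCoefficients.Default commutativeSemiring
    using (solve; _:=_; _:+_; _:*_; con)

  inv*nat-suc : ∀ n a → inv n * (nat (suc n) * a) ≈ a
  inv*nat-suc n a = begin
    inv n * (nat (suc n) * a)     ≈⟨ sym (*-assoc _ _ _) ⟩
    (inv n * nat (suc n)) * a     ≈⟨ *-cong (trans (*-comm _ _) (nat-suc*inv n)) refl ⟩
    1# * a                        ≈⟨ *-identityˡ a ⟩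
    a                             ∎

  nat-suc-cancelˡ : ∀ n {a b} → nat (suc n) * a ≈ nat (suc n) * b → a ≈ b
  nat-suc-cancelˡ n {a} {b} e = trans (sym (inv*nat-suc n a)) (trans (*-cong refl e) (inv*nat-suc n b))

  inv-0 : inv 0 ≈ 1#
  inv-0 = begin
    inv 0               ≈⟨ sym (*-identityˡ _) ⟩
    1# * inv 0          ≈⟨ *-cong (sym (+-identityʳ 1#)) refl ⟩
    nat 1 * inv 0       ≈⟨ nat-suc*inv 0 ⟩
    1#                  ∎

  nat-suc*invFact-suc : ∀ n → nat (suc n) * invFact (suc n) ≈ invFact n
  nat-suc*invFact-suc n = begin
    nat (suc n) * (invFact n * inv n) ≈⟨ *-lcomm _ _ _ ⟩
    invFact n * (nat (suc n) * inv n) ≈⟨ *-cong refl (nat-suc*inv n) ⟩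
    invFact n * 1#                    ≈⟨ *-identityʳ _ ⟩
    invFact n                         ∎

  -- Commutativity and associativity of ⊛ follow from Leibniz's rule by induction on the degree,
  -- cancelling the factor n + 1 that the derivative introduces.
  ⊛-comm : ∀ f g → (f ⊛ g) ≋ (g ⊛ f)
  ⊛-comm f g zero = *-comm _ _
  ⊛-comm f g (suc n) = nat-suc-cancelˡ n (begin
    deriv (f ⊛ g) n                         ≈⟨ deriv-⊛ f g n ⟩
    (deriv f ⊛ g) n + (f ⊛ deriv g) n       ≈⟨ +-cong (⊛-comm (deriv f) g n) (⊛-comm f (deriv g) n) ⟩
    (g ⊛ deriv f) n + (deriv g ⊛ f) n       ≈⟨ +-comm _ _ ⟩
    (deriv g ⊛ f) n + (g ⊛ deriv f) n       ≈⟨ sym (deriv-⊛ g f n) ⟩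
    deriv (g ⊛ f) n                         ∎)

  ⊛-assoc : ∀ f g h → ((f ⊛ g) ⊛ h) ≋ (f ⊛ (g ⊛ h))
  ⊛-assoc f g h zero = *-assoc _ _ _
  ⊛-assoc f g h (suc n) = nat-suc-cancelˡ n (begin
    deriv ((f ⊛ g) ⊛ h) n
      ≈⟨ deriv-⊛ (f ⊛ g) h n ⟩
    (deriv (f ⊛ g) ⊛ h) n + ((f ⊛ g) ⊛ deriv h) n
      ≈⟨ +-cong (trans (⊛-congˡ h (deriv-⊛ f g) n) (⊛-distribʳ (deriv f ⊛ g) (f ⊛ deriv g) h n)) refl ⟩
    (((deriv f ⊛ g) ⊛ h) n + ((f ⊛ deriv g) ⊛ h) n) + ((f ⊛ g) ⊛ deriv h) n
      ≈⟨ +-cong (+-cong (⊛-assoc (deriv f) g h n) (⊛-assoc f (deriv g) h n)) (⊛-assoc f g (deriv h) n) ⟩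
    ((deriv f ⊛ (g ⊛ h)) n + (f ⊛ (deriv g ⊛ h)) n) + (f ⊛ (g ⊛ deriv h)) n
      ≈⟨ +-assoc _ _ _ ⟩
    (deriv f ⊛ (g ⊛ h)) n + ((f ⊛ (deriv g ⊛ h)) n + (f ⊛ (g ⊛ deriv h)) n)
      ≈⟨ +-cong refl (sym (trans (⊛-congʳ f (deriv-⊛ g h) n) (⊛-distribˡ f (deriv g ⊛ h) (g ⊛ deriv h) n))) ⟩
    (deriv f ⊛ (g ⊛ h)) n + (f ⊛ deriv (g ⊛ h)) n
      ≈⟨ sym (deriv-⊛ f (g ⊛ h) n) ⟩
    deriv (f ⊛ (g ⊛ h)) n
      ∎)

  ⊛-const : ∀ a f → (f ⊛ const a) ≋ (a · f)
  ⊛-const a f = ≋-trans (⊛-comm f (const a)) (const-⊛ a f)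

  ⊛-rotate : ∀ f g h → ((f ⊛ g) ⊛ h) ≋ ((f ⊛ h) ⊛ g)
  ⊛-rotate f g h = ≋-trans (⊛-assoc f g h) (≋-trans (⊛-congʳ f (⊛-comm g h)) (≋-sym (⊛-assoc f h g)))

  ≋-from-deriv : ∀ {f g} → f 0 ≈ g 0 → deriv f ≋ deriv g → f ≋ g
  ≋-from-deriv e₀ e′ zero = e₀
  ≋-from-deriv e₀ e′ (suc n) = nat-suc-cancelˡ n (e′ n)

  t : PS
  t zero = 0#
  t (suc zero) = 1#
  t (suc (suc n)) = 0#

  ⊛-t-zero : ∀ f → (f ⊛ t) 0 ≈ 0#
  ⊛-t-zero f = zeroʳ _

  ⊛-t-suc : ∀ f n → (f ⊛ t) (suc n) ≈ f n
  ⊛-t-suc f n = begin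
    (f ⊛ t) (suc n)                        ≈⟨ ⊛-comm f t (suc n) ⟩
    (t ⊛ f) (suc n)                        ≈⟨ sumTo-suc-head n _ ⟩
    0# * f (suc n) + sumTo n (λ k → t (suc k) * f (n ∸ k))
                                           ≈⟨ +-cong (zeroˡ _) (sumTo-head n (λ k _ → zeroˡ _)) ⟩
    0# + 1# * f n                          ≈⟨ +-identityˡ _ ⟩
    1# * f n                               ≈⟨ *-identityˡ _ ⟩
    f n                                    ∎

  module Composition (u : PS) (u-0 : u 0 ≈ 0#) where

    open Substitution u u-0 public

    t-∘ₛ : (t ∘ₛ u) ≋ u
    t-∘ₛ zero = trans (zeroˡ _) (sym u-0)
    t-∘ₛ (suc n) = begin
      (t ∘ₛ u) (suc n)                           ≈⟨ sumTo-suc-head n _ ⟩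
      t 0 * pow u 0 (suc n) + sumTo n (λ k → t (suc k) * pow u (suc k) (suc n))
                                                 ≈⟨ +-cong (zeroˡ _) (sumTo-head n (λ k _ → zeroˡ _)) ⟩
      0# + 1# * (u ⊛ const 1#) (suc n)           ≈⟨ trans (+-identityˡ _) (*-identityˡ _) ⟩
      (u ⊛ const 1#) (suc n)                     ≈⟨ ⊛-const 1# u (suc n) ⟩
      1# * u (suc n)                             ≈⟨ *-identityˡ _ ⟩
      u (suc n)                                  ∎

    deriv-pow : ∀ k → deriv (pow u (suc k)) ≋ (nat (suc k) · (pow u k ⊛ deriv u))
    deriv-pow zero n = begin
      deriv (u ⊛ const 1#) n
        ≈⟨ deriv-cong (⊛-const 1# u) n ⟩
      deriv (1# · u) n
        ≈⟨ *-cong refl (*-identityˡ _) ⟩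
      deriv u n
        ≈⟨ sym (*-identityˡ _) ⟩
      1# * deriv u n
        ≈⟨ *-cong (sym (+-identityʳ 1#)) (sym (trans (const-⊛ 1# (deriv u) n) (*-identityˡ _))) ⟩
      nat 1 * (const 1# ⊛ deriv u) n
        ∎
    deriv-pow (suc k) n = begin
      deriv (u ⊛ pow u (suc k)) n
        ≈⟨ deriv-⊛ u (pow u (suc k)) n ⟩
      (deriv u ⊛ pow u (suc k)) n + (u ⊛ deriv (pow u (suc k))) n
        ≈⟨ +-cong (⊛-comm (deriv u) (pow u (suc k)) n) (⊛-congʳ u (deriv-pow k) n) ⟩
      P n + (u ⊛ (nat (suc k) · (pow u k ⊛ deriv u))) n
        ≈⟨ +-cong refl (·-⊛ʳ (nat (suc k)) u (pow u k ⊛ deriv u) n) ⟩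
      P n + nat (suc k) * (u ⊛ (pow u k ⊛ deriv u)) n
        ≈⟨ +-cong refl (*-cong refl (sym (⊛-assoc u (pow u k) (deriv u) n))) ⟩
      P n + nat (suc k) * P n
        ≈⟨ +-cong (sym (*-identityˡ _)) refl ⟩
      1# * P n + nat (suc k) * P n
        ≈⟨ sym (distribʳ _ _ _) ⟩
      nat (suc (suc k)) * P n
        ∎
      where
      P : PS
      P = pow u (suc k) ⊛ deriv u

    ∘ₛ-⊛-expand : ∀ X v n → ((X ∘ₛ u) ⊛ v) n ≈ sumTo n (λ k → X k * (pow u k ⊛ v) n)
    ∘ₛ-⊛-expand X v n = begin
      sumTo n (λ i → (X ∘ₛ u) i * v (n ∸ i))
        ≈⟨ sumTo-cong≤ n (λ i i≤n → *-cong (sym (∘ₛ-sumTo X n i≤n)) refl) ⟩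
      sumTo n (λ i → sumTo n (λ k → X k * pow u k i) * v (n ∸ i))
        ≈⟨ sumTo-cong n (λ i → trans (sumTo-*ʳ n _ _) (sumTo-cong n (λ k → *-assoc _ _ _))) ⟩
      sumTo n (λ i → sumTo n (λ k → X k * (pow u k i * v (n ∸ i))))
        ≈⟨ sumTo-swap n n _ ⟩
      sumTo n (λ k → sumTo n (λ i → X k * (pow u k i * v (n ∸ i))))
        ≈⟨ sumTo-cong n (λ k → sym (sumTo-*ˡ n _ _)) ⟩
      sumTo n (λ k → X k * (pow u k ⊛ v) n)
        ∎

    deriv-∘ₛ : ∀ X → deriv (X ∘ₛ u) ≋ ((deriv X ∘ₛ u) ⊛ deriv u)
    deriv-∘ₛ X n = begin
      nat (suc n) * sumTo (suc n) (λ k → X k * pow u k (suc n))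
        ≈⟨ trans (sumTo-*ˡ (suc n) _ _) (sumTo-cong (suc n) (λ k → *-lcomm _ _ _)) ⟩
      sumTo (suc n) (λ k → X k * deriv (pow u k) n)
        ≈⟨ sumTo-suc-head n _ ⟩
      X 0 * deriv (const 1#) n + sumTo n (λ k → X (suc k) * deriv (pow u (suc k)) n)
        ≈⟨ +-cong (trans (*-cong refl (deriv-const 1# n)) (zeroʳ _))
                  (sumTo-cong n (λ k → *-cong refl (deriv-pow k n))) ⟩
      0# + sumTo n (λ k → X (suc k) * (nat (suc k) * (pow u k ⊛ deriv u) n))
        ≈⟨ trans (+-identityˡ _) (sumTo-cong n (λ k → trans (sym (*-assoc _ _ _)) (*-cong (*-comm _ _) refl))) ⟩
      sumTo n (λ k → deriv X k * (pow u k ⊛ deriv u) n)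
        ≈⟨ sym (∘ₛ-⊛-expand (deriv X) (deriv u) n) ⟩
      ((deriv X ∘ₛ u) ⊛ deriv u) n
        ∎

    deriv-∘ₛ-⊛ : ∀ f g → deriv ((f ∘ₛ u) ⊛ (g ∘ₛ u))
                         ≋ ((((deriv f ∘ₛ u) ⊛ (g ∘ₛ u)) ⊕ ((f ∘ₛ u) ⊛ (deriv g ∘ₛ u))) ⊛ deriv u)
    deriv-∘ₛ-⊛ f g n = begin
      deriv (F ⊛ G) n
        ≈⟨ deriv-⊛ F G n ⟩
      ((deriv F ⊛ G) ⊕ (F ⊛ deriv G)) n
        ≈⟨ ⊕-cong (⊛-congˡ G (deriv-∘ₛ f)) (⊛-congʳ F (deriv-∘ₛ g)) n ⟩
      (((F′ ⊛ deriv u) ⊛ G) ⊕ (F ⊛ (G′ ⊛ deriv u))) n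
        ≈⟨ ⊕-cong (⊛-rotate F′ (deriv u) G) (≋-sym (⊛-assoc F G′ (deriv u))) n ⟩
      (((F′ ⊛ G) ⊛ deriv u) ⊕ ((F ⊛ G′) ⊛ deriv u)) n
        ≈⟨ sym (⊛-distribʳ (F′ ⊛ G) (F ⊛ G′) (deriv u) n) ⟩
      (((F′ ⊛ G) ⊕ (F ⊛ G′)) ⊛ deriv u) n
        ∎
      where
      F G F′ G′ : PS
      F = f ∘ₛ u
      G = g ∘ₛ u
      F′ = deriv f ∘ₛ u
      G′ = deriv g ∘ₛ u

    -- Stated on initial segments: the chain-rule step multiplies by u′, so it needs all lower coefficients.
    ∘ₛ-⊛-agreeUpTo : ∀ n f g → AgreeUpTo n ((f ⊛ g) ∘ₛ u) ((f ∘ₛ u) ⊛ (g ∘ₛ u))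
    ∘ₛ-⊛-agreeUpTo zero f g .0 z≤n =
      trans (*-identityʳ _) (sym (*-cong (*-identityʳ _) (*-identityʳ _)))
    ∘ₛ-⊛-agreeUpTo (suc n) f g = agreeUpTo-suc n (∘ₛ-⊛-agreeUpTo n f g) (nat-suc-cancelˡ n (begin
      deriv ((f ⊛ g) ∘ₛ u) n
        ≈⟨ deriv-∘ₛ (f ⊛ g) n ⟩
      ((deriv (f ⊛ g) ∘ₛ u) ⊛ deriv u) n
        ≈⟨ ⊛-congˡ (deriv u) (≋-trans (∘ₛ-cong (deriv-⊛ f g)) (∘ₛ-⊕ (deriv f ⊛ g) (f ⊛ deriv g))) n ⟩
      ((((deriv f ⊛ g) ∘ₛ u) ⊕ ((f ⊛ deriv g) ∘ₛ u)) ⊛ deriv u) n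
        ≈⟨ ⊛-agreeUpTo n (deriv u) (λ j j≤n →
             +-cong (∘ₛ-⊛-agreeUpTo n (deriv f) g j j≤n) (∘ₛ-⊛-agreeUpTo n f (deriv g) j j≤n)) ⟩
      ((((deriv f ∘ₛ u) ⊛ (g ∘ₛ u)) ⊕ ((f ∘ₛ u) ⊛ (deriv g ∘ₛ u))) ⊛ deriv u) n
        ≈⟨ sym (deriv-∘ₛ-⊛ f g n) ⟩
      deriv ((f ∘ₛ u) ⊛ (g ∘ₛ u)) n
        ∎))

    ∘ₛ-⊛ : ∀ f g → ((f ⊛ g) ∘ₛ u) ≋ ((f ∘ₛ u) ⊛ (g ∘ₛ u))
    ∘ₛ-⊛ f g n = ∘ₛ-⊛-agreeUpTo n f g n ℕ.≤-refl

    ⊛-suc : ∀ f n → (f ⊛ u) (suc n) ≈ sumTo n (λ k → f k * u (suc n ∸ k))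
    ⊛-suc f n = begin
      sumTo n (λ k → f k * u (suc n ∸ k)) + f (suc n) * u (n ∸ n)
        ≈⟨ +-cong refl (trans (*-cong refl (trans (reflexive (≡.cong u (ℕ.n∸n≡0 n))) u-0)) (zeroʳ _)) ⟩
      sumTo n (λ k → f k * u (suc n ∸ k)) + 0#
        ≈⟨ +-identityʳ _ ⟩
      sumTo n (λ k → f k * u (suc n ∸ k))
        ∎

    -- u = t + O(t²) is cancellable: the coefficient of tⁿ⁺¹ in f ⊛ u is fₙ plus terms in f₀, …, fₙ₋₁.
    ⊛-cancelʳ : u 1 ≈ 1# → ∀ {f g} → (f ⊛ u) ≋ (g ⊛ u) → f ≋ g
    ⊛-cancelʳ u-1 {f} {g} e n = agree n n ℕ.≤-refl
      where
      agree : ∀ n → AgreeUpTo n f g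
      agree zero .0 z≤n = begin
        f 0                ≈⟨ sym (trans (*-cong refl u-1) (*-identityʳ _)) ⟩
        f 0 * u 1          ≈⟨ sym (⊛-suc f 0) ⟩
        (f ⊛ u) 1          ≈⟨ e 1 ⟩
        (g ⊛ u) 1          ≈⟨ ⊛-suc g 0 ⟩
        g 0 * u 1          ≈⟨ trans (*-cong refl u-1) (*-identityʳ _) ⟩
        g 0                ∎
      agree (suc m) = agreeUpTo-suc m (agree m) (+-cancelˡ (S f) _ _ (begin
        S f + f (suc m)                 ≈⟨ sym (top f) ⟩
        (f ⊛ u) (suc (suc m))           ≈⟨ e (suc (suc m)) ⟩
        (g ⊛ u) (suc (suc m))           ≈⟨ top g ⟩
        S g + g (suc m)                 ≈⟨ +-cong (sym S-agree) refl ⟩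
        S f + g (suc m)                 ∎))
        where
        S : PS → Carrier
        S h = sumTo m (λ k → h k * u (suc (suc m) ∸ k))
        S-agree : S f ≈ S g
        S-agree = sumTo-cong≤ m (λ k k≤m → *-cong (agree m k k≤m) refl)
        u[1+m∸m]≈1# : u (suc m ∸ m) ≈ 1#
        u[1+m∸m]≈1# = trans (reflexive (≡.cong u (ℕ.m+n∸n≡m 1 m))) u-1
        top : ∀ h → (h ⊛ u) (suc (suc m)) ≈ S h + h (suc m)
        top h = trans (⊛-suc h (suc m)) (+-cong refl (trans (*-cong refl u[1+m∸m]≈1#) (*-identityʳ _)))

  module Degenerate (lam : Carrier) where

    δ : PS → PS
    δ f = deriv f ⊕ (lam · θ f)

    δ-⊛ : ∀ f g → δ (f ⊛ g) ≋ ((δ f ⊛ g) ⊕ (f ⊛ δ g))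
    δ-⊛ f g n = begin
      deriv (f ⊛ g) n + lam * θ (f ⊛ g) n       ≈⟨ +-cong (deriv-⊛ f g n) (*-cong refl (θ-⊛ f g n)) ⟩
      (A + B) + lam * (C + D)                   ≈⟨ +-cong refl (distribˡ _ _ _) ⟩
      (A + B) + (lam * C + lam * D)             ≈⟨ +-interchange _ _ _ _ ⟩
      (A + lam * C) + (B + lam * D)
        ≈⟨ +-cong (sym (trans (⊛-distribʳ (deriv f) (lam · θ f) g n) (+-cong refl (·-⊛ˡ lam (θ f) g n))))
                  (sym (trans (⊛-distribˡ f (deriv g) (lam · θ g) n) (+-cong refl (·-⊛ʳ lam f (θ g) n)))) ⟩
      (δ f ⊛ g) n + (f ⊛ δ g) n                 ∎
      where
      A B C D : Carrier
      A = (deriv f ⊛ g) n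
      B = (f ⊛ deriv g) n
      C = (θ f ⊛ g) n
      D = (f ⊛ θ g) n

    δ-· : ∀ a f → δ (a · f) ≋ (a · δ f)
    δ-· a f n = begin
      nat (suc n) * (a * f (suc n)) + lam * (nat n * (a * f n))
        ≈⟨ +-cong (*-lcomm _ _ _) (trans (*-cong refl (*-lcomm _ _ _)) (*-lcomm _ _ _)) ⟩
      a * (nat (suc n) * f (suc n)) + a * (lam * (nat n * f n))
        ≈⟨ sym (distribˡ _ _ _) ⟩
      a * δ f n
        ∎

    deriv-δ : ∀ f → deriv (δ f) ≋ (δ (deriv f) ⊕ (lam · deriv f))
    deriv-δ f n = solve 4 (λ N l F G → (con 1 :+ N) :* ((con 1 :+ (con 1 :+ N)) :* G :+ l :* ((con 1 :+ N) :* F))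
                                   := ((con 1 :+ N) :* ((con 1 :+ (con 1 :+ N)) :* G) :+ l :* (N :* ((con 1 :+ N) :* F)))
                                      :+ l :* ((con 1 :+ N) :* F))
                        refl (nat n) lam (f (suc n)) (f (suc (suc n)))

    Eigen : Carrier → PS → Set ℓ
    Eigen a f = δ f ≋ (a · f)

    private
      eigen-coeff : ∀ a N y → (a - N * lam) * y + lam * (N * y) ≈ a * y
      eigen-coeff a N y = begin
        (a - N * lam) * y + lam * (N * y)
          ≈⟨ +-cong (distribʳ _ _ _) (trans (*-lcomm _ _ _) (sym (*-assoc _ _ _))) ⟩
        (a * y + - (N * lam) * y) + (N * lam) * y
          ≈⟨ +-assoc _ _ _ ⟩
        a * y + (- (N * lam) * y + (N * lam) * y)
          ≈⟨ +-cong refl (trans (sym (distribʳ _ _ _)) (trans (*-cong (-‿inverseˡ _) refl) (zeroˡ _))) ⟩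
        a * y + 0#
          ≈⟨ +-identityʳ _ ⟩
        a * y
          ∎

    eigen-recurrence : ∀ {a f} → Eigen a f → ∀ n → nat (suc n) * f (suc n) ≈ (a - nat n * lam) * f n
    eigen-recurrence {a} {f} e n =
      +-cancelʳ (lam * (nat n * f n)) _ _ (trans (e n) (sym (eigen-coeff a (nat n) (f n))))

    recurrence-eigen : ∀ {a f} → (∀ n → nat (suc n) * f (suc n) ≈ (a - nat n * lam) * f n) → Eigen a f
    recurrence-eigen {a} {f} r n = trans (+-cong (r n) refl) (eigen-coeff a (nat n) (f n))

    eigen-unique : ∀ {a f g} → Eigen a f → Eigen a g → f 0 ≈ g 0 → f ≋ g
    eigen-unique {a} {f} {g} ef eg e₀ zero = e₀
    eigen-unique {a} {f} {g} ef eg e₀ (suc n) = nat-suc-cancelˡ n (begin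
      nat (suc n) * f (suc n)       ≈⟨ eigen-recurrence ef n ⟩
      (a - nat n * lam) * f n       ≈⟨ *-cong refl (eigen-unique ef eg e₀ n) ⟩
      (a - nat n * lam) * g n       ≈⟨ sym (eigen-recurrence eg n) ⟩
      nat (suc n) * g (suc n)       ∎)

    eigen-· : ∀ {a f} c → Eigen a f → Eigen a (c · f)
    eigen-· {a} {f} c e n = trans (δ-· c f n) (trans (*-cong refl (e n)) (*-lcomm _ _ _))

    eigen-⊛ : ∀ {a b f g} → Eigen a f → Eigen b g → Eigen (a + b) (f ⊛ g)
    eigen-⊛ {a} {b} {f} {g} ef eg n = begin
      δ (f ⊛ g) n                          ≈⟨ δ-⊛ f g n ⟩
      (δ f ⊛ g) n + (f ⊛ δ g) n            ≈⟨ +-cong (⊛-congˡ g ef n) (⊛-congʳ f eg n) ⟩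
      ((a · f) ⊛ g) n + (f ⊛ (b · g)) n    ≈⟨ +-cong (·-⊛ˡ a f g n) (·-⊛ʳ b f g n) ⟩
      a * (f ⊛ g) n + b * (f ⊛ g) n        ≈⟨ sym (distribʳ _ _ _) ⟩
      (a + b) * (f ⊛ g) n                  ∎

    eigen-deriv : ∀ {a f} → Eigen a f → Eigen (a - lam) (deriv f)
    eigen-deriv {a} {f} e n = begin
      δ (deriv f) n                                    ≈⟨ sym ([y+x]-x≈y _ _) ⟩
      (δ (deriv f) n + lam * deriv f n) - lam * deriv f n
                                                       ≈⟨ +-cong (sym (deriv-δ f n)) refl ⟩
      deriv (δ f) n - lam * deriv f n                  ≈⟨ +-cong (trans (deriv-cong e n) (*-lcomm _ _ _)) refl ⟩
      a * deriv f n - lam * deriv f n                  ≈⟨ sym ([y-z]x≈yx-zx _ _ _) ⟩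
      (a - lam) * deriv f n                            ∎

    x-0λ≈x : ∀ x → x - nat 0 * lam ≈ x
    x-0λ≈x x = trans (+-cong refl (trans (-‿cong (zeroˡ lam)) -0#≈0#)) (+-identityʳ x)

    fall-cong : ∀ {x y} n → x ≈ y → fall x lam n ≈ fall y lam n
    fall-cong zero e = refl
    fall-cong (suc n) e = *-cong (fall-cong n e) (+-cong e refl)

    degExp-cong : ∀ {a b} → a ≈ b → degExp lam a ≋ degExp lam b
    degExp-cong e n = *-cong (fall-cong n e) refl

    eigen-degExp : ∀ a → Eigen a (degExp lam a)
    eigen-degExp a = recurrence-eigen (λ n → begin
      nat (suc n) * ((fall a lam n * κ n) * invFact (suc n))
        ≈⟨ solve 4 (λ S F C J → S :* ((F :* C) :* J) := C :* (F :* (S :* J))) refl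
                   (nat (suc n)) (fall a lam n) (κ n) (invFact (suc n)) ⟩
      κ n * (fall a lam n * (nat (suc n) * invFact (suc n)))
        ≈⟨ *-cong refl (*-cong refl (nat-suc*invFact-suc n)) ⟩
      κ n * degExp lam a n
        ∎)
      where
      κ : ℕ → Carrier
      κ n = a - nat n * lam

    degExp-+ : ∀ a b → (degExp lam a ⊛ degExp lam b) ≋ degExp lam (a + b)
    degExp-+ a b = eigen-unique (eigen-⊛ (eigen-degExp a) (eigen-degExp b)) (eigen-degExp (a + b))
                                (*-cong (*-identityˡ 1#) (*-identityˡ 1#))

    degExp-0# : degExp lam 0# ≋ const 1#
    degExp-0# zero = *-identityˡ 1#
    degExp-0# (suc n) = trans (*-cong (fall-0# n) refl) (zeroˡ _)
      where
      fall-0# : ∀ n → fall 0# lam (suc n) ≈ 0#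
      fall-0# zero = trans (*-identityˡ _) (x-0λ≈x 0#)
      fall-0# (suc n) = trans (*-cong (fall-0# n) refl) (zeroˡ _)

    deriv-degExp : ∀ a → deriv (degExp lam a) ≋ (a · degExp lam (a - lam))
    deriv-degExp a = eigen-unique (eigen-deriv (eigen-degExp a)) (eigen-· a (eigen-degExp (a - lam))) (begin
      nat 1 * ((1# * (a - nat 0 * lam)) * (1# * inv 0))
        ≈⟨ *-cong (+-identityʳ 1#) (*-cong (*-identityˡ _) (*-identityˡ _)) ⟩
      1# * ((a - nat 0 * lam) * inv 0)
        ≈⟨ trans (*-identityˡ _) (*-cong (x-0λ≈x a) inv-0) ⟩
      a * 1#
        ≈⟨ *-cong refl (sym (*-identityˡ 1#)) ⟩
      a * (1# * 1#)
        ∎)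

  deriv-expS : deriv expS ≋ expS
  deriv-expS = nat-suc*invFact-suc

  expS-⊛-deriv : ∀ f → (expS ⊛ deriv f) ≋ (deriv (expS ⊛ f) ⊖ (expS ⊛ f))
  expS-⊛-deriv f n = begin
    (expS ⊛ deriv f) n
      ≈⟨ sym ([y+x]-x≈y _ _) ⟩
    ((expS ⊛ deriv f) n + (expS ⊛ f) n) - (expS ⊛ f) n
      ≈⟨ +-cong (trans (+-comm _ _) (+-cong (sym (⊛-congˡ f deriv-expS n)) refl)) refl ⟩
    ((deriv expS ⊛ f) n + (expS ⊛ deriv f) n) - (expS ⊛ f) n
      ≈⟨ +-cong (sym (deriv-⊛ expS f n)) refl ⟩
    deriv (expS ⊛ f) n - (expS ⊛ f) n
      ∎

  expNeg : PS
  expNeg k = sgn k * invFact k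

  deriv-expNeg : deriv expNeg ≋ (⊝ expNeg)
  deriv-expNeg n = begin
    nat (suc n) * ((- 1# * sgn n) * invFact (suc n))   ≈⟨ *-lcomm _ _ _ ⟩
    (- 1# * sgn n) * (nat (suc n) * invFact (suc n))   ≈⟨ *-cong refl (nat-suc*invFact-suc n) ⟩
    (- 1# * sgn n) * invFact n                         ≈⟨ *-assoc _ _ _ ⟩
    - 1# * expNeg n                                    ≈⟨ -1*x≈-x _ ⟩
    - expNeg n                                         ∎

  expS-⊛-expNeg : (expS ⊛ expNeg) ≋ const 1#
  expS-⊛-expNeg = ≋-from-deriv (trans (*-identityˡ _) (*-identityˡ _)) (λ n → begin
    deriv (expS ⊛ expNeg) n
      ≈⟨ deriv-⊛ expS expNeg n ⟩
    (deriv expS ⊛ expNeg) n + (expS ⊛ deriv expNeg) n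
      ≈⟨ +-cong (⊛-congˡ expNeg deriv-expS n) (⊛-congʳ expS deriv-expNeg n) ⟩
    (expS ⊛ expNeg) n + (expS ⊛ (⊝ expNeg)) n
      ≈⟨ +-cong refl (⊝-⊛ʳ expS expNeg n) ⟩
    (expS ⊛ expNeg) n - (expS ⊛ expNeg) n
      ≈⟨ -‿inverseʳ _ ⟩
    0#
      ≈⟨ sym (deriv-const 1# n) ⟩
    deriv (const 1#) n
      ∎)

  -- (1 - e^{-x}) / x
  Q : PS
  Q k = sgn k * invFact (suc k)

  Q-⊛-t : (Q ⊛ t) ≋ (const 1# ⊖ expNeg)
  Q-⊛-t zero = begin
    (Q ⊛ t) 0            ≈⟨ ⊛-t-zero Q ⟩
    0#                   ≈⟨ sym (-‿inverseʳ 1#) ⟩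
    1# - 1#              ≈⟨ +-cong refl (-‿cong (sym (*-identityˡ 1#))) ⟩
    1# - expNeg 0        ∎
  Q-⊛-t (suc k) = begin
    (Q ⊛ t) (suc k)                      ≈⟨ ⊛-t-suc Q k ⟩
    sgn k * invFact (suc k)              ≈⟨ sym (-‿involutive _) ⟩
    - - (sgn k * invFact (suc k))        ≈⟨ -‿cong (trans (sym (-1*x≈-x _)) (sym (*-assoc _ _ _))) ⟩
    - expNeg (suc k)                     ≈⟨ sym (+-identityˡ _) ⟩
    0# - expNeg (suc k)                  ∎

  -- tailExp m = m! x^{-m-1} (e^x - Σ_{j ≤ m} x^j / j!)
  tailExp : ℕ → PS
  tailExp m k = fact m * invFact (suc (k +ℕ m))

  expS-⊛-Q : (expS ⊛ Q) ≋ tailExp 0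
  expS-⊛-Q k = begin
    (expS ⊛ Q) k                          ≈⟨ sym (⊛-t-suc (expS ⊛ Q) k) ⟩
    ((expS ⊛ Q) ⊛ t) (suc k)              ≈⟨ ⊛-assoc expS Q t (suc k) ⟩
    (expS ⊛ (Q ⊛ t)) (suc k)              ≈⟨ ⊛-congʳ expS Q-⊛-t (suc k) ⟩
    (expS ⊛ (const 1# ⊖ expNeg)) (suc k)  ≈⟨ ⊛-distribˡ expS (const 1#) (⊝ expNeg) (suc k) ⟩
    (expS ⊛ const 1#) (suc k) + (expS ⊛ (⊝ expNeg)) (suc k)
                                          ≈⟨ +-cong (⊛-const 1# expS (suc k)) (⊝-⊛ʳ expS expNeg (suc k)) ⟩
    1# * invFact (suc k) - (expS ⊛ expNeg) (suc k)
                                          ≈⟨ +-cong refl (trans (-‿cong (expS-⊛-expNeg (suc k))) -0#≈0#) ⟩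
    1# * invFact (suc k) + 0#             ≈⟨ +-identityʳ _ ⟩
    1# * invFact (suc k)                  ≡⟨ ≡.cong (λ j → 1# * invFact (suc j)) (≡.sym (ℕ.+-identityʳ k)) ⟩
    tailExp 0 k                           ∎

  tailExp-suc : ∀ m → tailExp (suc m) ≋ (tailExp m ⊖ deriv (tailExp m))
  tailExp-suc m k = begin
    (b * F) * invFact (suc (k +ℕ suc m))
      ≡⟨ ≡.cong (λ j → (b * F) * invFact (suc j)) (ℕ.+-suc k m) ⟩
    (b * F) * J
      ≈⟨ solve 3 (λ b F J → b :* F :* J := F :* (b :* J)) refl b F J ⟩
    F * (b * J)
      ≈⟨ sym ([y+x]-x≈y _ _) ⟩
    (F * (b * J) + F * (a * J)) - F * (a * J)
      ≈⟨ +-cong (solve 4 (λ a b F J → F :* (b :* J) :+ F :* (a :* J) := F :* ((a :+ b) :* J)) refl a b F J)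
                refl ⟩
    F * ((a + b) * J) - F * (a * J)
      ≈⟨ +-cong (*-cong refl (trans (*-cong (sym nat-split) refl) (nat-suc*invFact-suc N))) (-‿cong (*-lcomm _ _ _)) ⟩
    F * invFact N - a * (F * J)
      ∎
    where
    a b F J : Carrier
    N : ℕ
    a = nat (suc k)
    b = nat (suc m)
    F = fact m
    N = suc (k +ℕ m)
    J = invFact (suc N)
    nat-split : nat (suc N) ≈ a + b
    nat-split = trans (reflexive (≡.cong (λ j → nat (suc j)) (≡.sym (ℕ.+-suc k m))))
                      (nat-+ (suc k) (suc m))

  sgn-·-step : ∀ m {W W′} → W′ ≋ (deriv W ⊖ W) → (sgn (suc m) · W′) ≋ ((sgn m · W) ⊖ deriv (sgn m · W))
  sgn-·-step m {W} {W′} e n = begin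
    (- 1# * s) * W′ n                 ≈⟨ trans (*-assoc _ _ _) (-1*x≈-x _) ⟩
    - (s * W′ n)                      ≈⟨ -‿cong (trans (*-cong refl (e n)) (x[y-z]≈xy-xz _ _ _)) ⟩
    - (s * deriv W n - s * W n)       ≈⟨ ⁻¹-anti-homo‿- _ _ ⟩
    s * W n - s * deriv W n           ≈⟨ +-cong refl (-‿cong (*-lcomm _ _ _)) ⟩
    s * W n - deriv (sgn m · W) n     ∎
    where
    s : Carrier
    s = sgn m

  tailExp≋expS-⊛-iter-deriv-Q : ∀ m → tailExp m ≋ (sgn m · (expS ⊛ iter m deriv Q))
  tailExp≋expS-⊛-iter-deriv-Q zero k = trans (sym (expS-⊛-Q k)) (sym (*-identityˡ _))
  tailExp≋expS-⊛-iter-deriv-Q (suc m) =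
    ≋-trans (tailExp-suc m)
   (≋-trans (⊕-cong IH (⊝-cong (deriv-cong IH)))
            (≋-sym (sgn-·-step m (expS-⊛-deriv (iter m deriv Q)))))
    where
    IH : tailExp m ≋ (sgn m · (expS ⊛ iter m deriv Q))
    IH = tailExp≋expS-⊛-iter-deriv-Q m

  bel : ℕ → PS
  bel p k = fact p * invFact (k +ℕ p)

  bel-suc≋expS-⊛-iter-deriv-Q : ∀ m → bel (suc m) ≋ ((sgn m * nat (suc m)) · (expS ⊛ iter m deriv Q))
  bel-suc≋expS-⊛-iter-deriv-Q m k = begin
    (nat (suc m) * fact m) * invFact (k +ℕ suc m)
      ≡⟨ ≡.cong (λ j → (nat (suc m) * fact m) * invFact j) (ℕ.+-suc k m) ⟩
    (nat (suc m) * fact m) * invFact (suc (k +ℕ m))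
      ≈⟨ *-assoc _ _ _ ⟩
    nat (suc m) * tailExp m k
      ≈⟨ *-cong refl (tailExp≋expS-⊛-iter-deriv-Q m k) ⟩
    nat (suc m) * (sgn m * (expS ⊛ iter m deriv Q) k)
      ≈⟨ trans (sym (*-assoc _ _ _)) (*-cong (*-comm _ _) refl) ⟩
    (sgn m * nat (suc m)) * (expS ⊛ iter m deriv Q) k
      ∎

  expS-∘ₛ-⊝ : ∀ u → (expS ∘ₛ (⊝ u)) ≋ (expNeg ∘ₛ u)
  expS-∘ₛ-⊝ u n = sumTo-cong n (λ k →
    trans (*-cong refl (pow-⊝ u k n)) (solve 3 (λ I S P → I :* (S :* P) := (S :* I) :* P) refl _ _ _))

  module Bell (lam : Carrier) where
    open Degenerate lam

    u : PS
    u = eλm1 lam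

    u-0 : u 0 ≈ 0#
    u-0 = trans (+-cong (*-identityˡ 1#) refl) (-‿inverseʳ 1#)

    u-1 : u 1 ≈ 1#
    u-1 = begin
      (1# * (1# - nat 0 * lam)) * (1# * inv 0) - 0#
        ≈⟨ trans (+-cong refl -0#≈0#) (+-identityʳ _) ⟩
      (1# * (1# - nat 0 * lam)) * (1# * inv 0)
        ≈⟨ *-cong (trans (*-identityˡ _) (x-0λ≈x 1#)) (trans (*-identityˡ _) inv-0) ⟩
      1# * 1#
        ≈⟨ *-identityˡ 1# ⟩
      1#
        ∎

    open Composition u u-0

    degExp-⊛-deriv-u : (degExp lam (lam - 1#) ⊛ deriv u) ≋ const 1#
    degExp-⊛-deriv-u n = begin
      (degExp lam (lam - 1#) ⊛ deriv u) n
        ≈⟨ ⊛-congʳ (degExp lam (lam - 1#)) deriv-u n ⟩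
      (degExp lam (lam - 1#) ⊛ (1# · degExp lam (1# - lam))) n
        ≈⟨ ·-⊛ʳ 1# (degExp lam (lam - 1#)) (degExp lam (1# - lam)) n ⟩
      1# * (degExp lam (lam - 1#) ⊛ degExp lam (1# - lam)) n
        ≈⟨ trans (*-identityˡ _) (degExp-+ (lam - 1#) (1# - lam) n) ⟩
      degExp lam ((lam - 1#) + (1# - lam)) n
        ≈⟨ degExp-cong (trans (+-cong refl (sym (⁻¹-anti-homo‿- _ _))) (-‿inverseʳ _)) n ⟩
      degExp lam 0# n
        ≈⟨ degExp-0# n ⟩
      const 1# n
        ∎
      where
      deriv-u : deriv u ≋ (1# · degExp lam (1# - lam))
      deriv-u n = trans (*-cong refl (trans (+-cong refl -0#≈0#) (+-identityʳ _))) (deriv-degExp 1# n)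

    Dop-∘ₛ : ∀ X → Dop lam (X ∘ₛ u) ≋ (deriv X ∘ₛ u)
    Dop-∘ₛ X n = begin
      (E ⊛ deriv (X ∘ₛ u)) n              ≈⟨ ⊛-congʳ E (deriv-∘ₛ X) n ⟩
      (E ⊛ ((deriv X ∘ₛ u) ⊛ deriv u)) n  ≈⟨ ⊛-congʳ E (⊛-comm (deriv X ∘ₛ u) (deriv u)) n ⟩
      (E ⊛ (deriv u ⊛ (deriv X ∘ₛ u))) n  ≈⟨ sym (⊛-assoc E (deriv u) (deriv X ∘ₛ u) n) ⟩
      ((E ⊛ deriv u) ⊛ (deriv X ∘ₛ u)) n  ≈⟨ ⊛-congˡ (deriv X ∘ₛ u) degExp-⊛-deriv-u n ⟩
      (const 1# ⊛ (deriv X ∘ₛ u)) n       ≈⟨ trans (const-⊛ 1# (deriv X ∘ₛ u) n) (*-identityˡ _) ⟩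
      (deriv X ∘ₛ u) n                    ∎
      where
      E : PS
      E = degExp lam (lam - 1#)

    iter-Dop-cong : ∀ m {f g} → f ≋ g → iter m (Dop lam) f ≋ iter m (Dop lam) g
    iter-Dop-cong zero e = e
    iter-Dop-cong (suc m) e = ⊛-congʳ (degExp lam (lam - 1#)) (deriv-cong (iter-Dop-cong m e))

    iter-Dop-∘ₛ : ∀ m X → iter m (Dop lam) (X ∘ₛ u) ≋ (iter m deriv X ∘ₛ u)
    iter-Dop-∘ₛ zero X = ≋-refl
    iter-Dop-∘ₛ (suc m) X = ≋-trans (iter-Dop-cong 1 (iter-Dop-∘ₛ m X)) (Dop-∘ₛ (iter m deriv X))

    numer≋ : numer lam ≋ ((const 1# ⊖ expNeg) ∘ₛ u)
    numer≋ n = begin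
      const 1# n - (expS ∘ₛ (⊝ u)) n
        ≈⟨ +-cong (sym (const-∘ₛ 1# n)) (-‿cong (expS-∘ₛ-⊝ u n)) ⟩
      (const 1# ∘ₛ u) n - (expNeg ∘ₛ u) n
        ≈⟨ +-cong refl (sym (∘ₛ-⊝ expNeg n)) ⟩
      (const 1# ∘ₛ u) n + ((⊝ expNeg) ∘ₛ u) n
        ≈⟨ sym (∘ₛ-⊕ (const 1#) (⊝ expNeg) n) ⟩
      ((const 1# ⊖ expNeg) ∘ₛ u) n
        ∎

    Q-∘ₛ-⊛-u : ((Q ∘ₛ u) ⊛ u) ≋ numer lam
    Q-∘ₛ-⊛-u n = begin
      ((Q ∘ₛ u) ⊛ u) n                  ≈⟨ ⊛-congʳ (Q ∘ₛ u) (≋-sym t-∘ₛ) n ⟩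
      ((Q ∘ₛ u) ⊛ (t ∘ₛ u)) n           ≈⟨ sym (∘ₛ-⊛ Q t n) ⟩
      ((Q ⊛ t) ∘ₛ u) n                  ≈⟨ ∘ₛ-cong Q-⊛-t n ⟩
      ((const 1# ⊖ expNeg) ∘ₛ u) n      ≈⟨ sym (numer≋ n) ⟩
      numer lam n                       ∎

    BelGF-suc≋RHS : ∀ m q → (q ⊛ u) ≋ numer lam → BelGF lam (suc m) ≋ RHS lam (suc m) q
    BelGF-suc≋RHS m q q-⊛-u n = begin
      (bel (suc m) ∘ₛ u) n
        ≈⟨ ∘ₛ-cong (bel-suc≋expS-⊛-iter-deriv-Q m) n ⟩
      ((σ · (expS ⊛ iter m deriv Q)) ∘ₛ u) n
        ≈⟨ ∘ₛ-· σ (expS ⊛ iter m deriv Q) n ⟩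
      σ * ((expS ⊛ iter m deriv Q) ∘ₛ u) n
        ≈⟨ *-cong refl (∘ₛ-⊛ expS (iter m deriv Q) n) ⟩
      σ * (expEλm1 lam ⊛ (iter m deriv Q ∘ₛ u)) n
        ≈⟨ *-cong refl (⊛-congʳ (expEλm1 lam) (≋-sym (iter-Dop-∘ₛ m Q)) n) ⟩
      σ * (expEλm1 lam ⊛ iter m (Dop lam) (Q ∘ₛ u)) n
        ≈⟨ *-cong refl (⊛-congʳ (expEλm1 lam) (iter-Dop-cong m q≋) n) ⟩
      σ * (expEλm1 lam ⊛ iter m (Dop lam) q) n
        ∎
      where
      σ : Carrier
      σ = sgn m * nat (suc m)
      q≋ : (Q ∘ₛ u) ≋ q
      q≋ = ⊛-cancelʳ u-1 (≋-trans Q-∘ₛ-⊛-u (≋-sym q-⊛-u))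

theorem7 : ∀ {c ℓ} (R : CommutativeRing c ℓ) (inv : ℕ → CommutativeRing.Carrier R)
    → (∀ n → CommutativeRing._≈_ R (CommutativeRing._*_ R (FPS.nat R inv (suc n)) (inv n)) (CommutativeRing.1# R))
    → (lam : CommutativeRing.Carrier R) (p : ℕ) → 1 ≤ p
    → Σ (FPS.PS R inv) (λ q → FPS._≋_ R inv (FPS._⊛_ R inv q (FPS.eλm1 R inv lam)) (FPS.numer R inv lam))
    × (∀ q → FPS._≋_ R inv (FPS._⊛_ R inv q (FPS.eλm1 R inv lam)) (FPS.numer R inv lam)
    → FPS._≋_ R inv (FPS.BelGF R inv lam p) (FPS.RHS R inv lam p q))
theorem7 R inv nat-suc*inv lam (suc m) (s≤s _) = (Q ∘ₛ u , Q-∘ₛ-⊛-u) , BelGF-suc≋RHS m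
  where
  open FPS R inv using (_∘ₛ_)
  open ℚAlgebraPowerSeries R inv nat-suc*inv using (Q; module Bell)
  open Bell lam
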